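{- Let $X=\{a_1,\dots,a_n\}$, let $\mathcal{F}$ be a union-closed family of subsets of $X$ with $\bigcup_{f\in\mathcal{F}}f=X$, and let $w=a_1\cdots a_n$. For every $a\in X$, $$|\pi_w(a)|-|\sigma_w(a)|=|P(\mathcal{F},a)|-|S(\mathcal{F},a)|;$$ consequently, there exists $a\in X$ with $|\mathcal{F}_a|\ge|\mathcal{F}|/2$ if and only if $|\pi_w(a)|\ge|\sigma_w(a)|$ for some $a\in X$. Moreover $|\pi_w(a)|\le|P(\mathcal{F},a)|$ and $|\sigma_w(a)|\le|S(\mathcal{F},a)|$ for every $a\in X$.
   Context: Union-closed: $f,g\in\mathcal{F}\Rightarrow f\cup g\in\mathcal{F}$. $\mathcal{F}_a=\{f\in\mathcal{F}:a\in f\}$. $S(\mathcal{F},a)=\{z\in\mathcal{F}:z\cup\{a\}\notin\mathcal{F}\}$, $P(\mathcal{F},a)=\{z\in\mathcal{F}:z\setminus\{a\}\notin\mathcal{F}\}$. Rising functions: for $T\subseteq 2^X$, $b\in X$, $\varphi_{T,b}(z)=z\cup\{b\}$ if $z\cup\{b\}\notin T$, and $z$ otherwise; with $\varphi_0=\mathrm{id}$, $\mathcal{F}_0=\mathcal{F}$, $\varphi_j=\varphi_{\mathcal{F}_{j-1},a_j}\circ\varphi_{j-1}$, $\mathcal{F}_j=\varphi_j(\mathcal{F})$, set $\varphi_w=\varphi_n$ (injective on $\mathcal{F}$). Spurious elements: $\sigma_w(a)=\{\eta\in\varphi_w(\mathcal{F}): a\in\eta\setminus\varphi_w^{ -1}(\eta)\}$.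 Pure elements: $\pi_w(a)=\{\eta\in\varphi_w(\mathcal{F}_a):\eta\setminus\{a\}\notin\varphi_w(\mathcal{F})\}$. -}

module Defs where

open import Data.Nat using (ℕ)
open import Data.Bool using (Bool)
import Data.Bool as B
open import Data.Fin using (Fin)
open import Data.Fin.Subset using (Subset; _∪_; _-_; ⁅_⁆) renaming (_∈_ to _∈ˢ_; _∉_ to _∉ˢ_)
open import Data.Fin.Subset.Properties using (_∈?_)
open import Data.Vec.Properties using (≡-dec)
open import Data.List using (List; []; _∷_; map; filter; length; deduplicate; allFin)
open import Data.List.Membership.Propositional using (_∈_; _∉_)
import Data.List.Membership.DecPropositional as DecMem
open import Data.List.Relation.Unary.Any using (Any; any?)
open import Data.Product using (Σ; _×_; _,_)
open import Data.Product.Properties using ()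
open import Relation.Binary.PropositionalEquality using (_≡_)
open import Relation.Binary.Definitions using (DecidableEquality)
open import Relation.Nullary using (Dec; yes; no; ¬?)
open import Relation.Nullary.Decidable using (_×-dec_)
open import Function using (id; _∘_)

-- Ground set X = {a_1,...,a_n} is Fin n; a_j is the (j-1)-th element of Fin n.
-- A family of subsets of X is a list of subsets (finite sets encoded as
-- duplicate-free lists where cardinality matters).
Family : ℕ → Set
Family n = List (Subset n)

_≟ˢ_ : ∀ {n} → DecidableEquality (Subset n)
_≟ˢ_ = ≡-dec B._≟_

_∈ᶠ?_ : ∀ {n} (z : Subset n) (T : Family n) → Dec (z ∈ T)
_∈ᶠ?_ = DecMem._∈?_ _≟ˢ_

UnionClosed : ∀ {n} → Family n → Set
UnionClosed F = ∀ f g → f ∈ F → g ∈ F → (f ∪ g) ∈ F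

Covers : ∀ {n} → Family n → Set
Covers {n} F = ∀ (x : Fin n) → Σ (Subset n) λ f → f ∈ F × x ∈ˢ f

image : ∀ {n} → (Subset n → Subset n) → Family n → Family n
image φ F = deduplicate _≟ˢ_ (map φ F)

Fa : ∀ {n} → Family n → Fin n → Family n
Fa F a = filter (a ∈?_) F

S : ∀ {n} → Family n → Fin n → Family n
S F a = filter (λ z → ¬? ((z ∪ ⁅ a ⁆) ∈ᶠ? F)) F

P : ∀ {n} → Family n → Fin n → Family n
P F a = filter (λ z → ¬? ((z - a) ∈ᶠ? F)) F

rise : ∀ {n} → Family n → Fin n → Subset n → Subset n
rise T b z with (z ∪ ⁅ b ⁆) ∈ᶠ? T
... | yes _ = z
... | no  _ = z ∪ ⁅ b ⁆

-- Given the current φ_{j-1} and the remaining letters a_j ... a_n of the word,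
-- compute φ_n, where φ_j = φ_{F_{j-1}, a_j} ∘ φ_{j-1} and F_{j-1} = φ_{j-1}(F).
riseWord : ∀ {n} → Family n → List (Fin n) → (Subset n → Subset n) → Subset n → Subset n
riseWord F []       φ = φ
riseWord F (b ∷ bs) φ = riseWord F bs (rise (image φ F) b ∘ φ)

φw : ∀ {n} → Family n → Subset n → Subset n
φw {n} F = riseWord F (allFin n) id

πw : ∀ {n} → Family n → Fin n → Family n
πw F a = filter (λ η → ¬? ((η - a) ∈ᶠ? image (φw F) F)) (image (φw F) (Fa F a))

-- σ_w(a) = { η ∈ φ_w(F) : a ∈ η \ φ_w⁻¹(η) }, where φ_w⁻¹(η) is the
-- element z ∈ F with φ_w(z) = η (unique since φ_w is injective on F).
σw : ∀ {n} → Family n → Fin n → Family n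
σw F a = filter (λ η → (a ∈? η) ×-dec any? (λ z → (φw F z ≟ˢ η) ×-dec ¬? (a ∈? z)) F)
                (image (φw F) F)

module Submission where

-- The proof rests on one counting identity, valid for every duplicate-free
-- family L and letter a (module Balance):  |P(L,a)| + |L| = 2|L_a| + |S(L,a)|,
-- because z ↦ z ∖ a matches the members of L_a whose removal of a stays in L
-- with the members outside L_a whose extension by a stays in L.
-- For L = F this says |P| - |S| = 2|F_a| - |F|.  For the image G = φ_w(F) it
-- yields |π_w(a)| + |F| = 2|F_a| + |σ_w(a)| (WordCount.pure-balance), using that
-- φ_w is injective and extensive on F, that G is closed under adding a (so
-- S(G,a) is empty), |G_a| = |F_a| + |σ_w(a)| and |P(G,a)| = |π_w(a)| + |σ_w(a)|.

open import Defs
open import Data.Nat using (ℕ; suc; _+_; _*_; _≤_; z≤n; s≤s)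
open import Data.Nat.Properties
  using (≤-trans; m≤n⇒m≤1+n; +-suc; +-comm; +-identityʳ;
         +-cancelʳ-≡; +-cancelʳ-≤; +-monoʳ-≤; ≤-antisym)
open import Data.Fin using (Fin; _≟_)
-- Removal of one element, p - a, is written p ∖ a to keep _-_ for integers.
open import Data.Fin.Subset using (Subset; _∪_; _─_; ⁅_⁆; _⊆_; inside)
  renaming (_∈_ to _∈ˢ_; _∉_ to _∉ˢ_; _-_ to _∖_)
open import Data.Fin.Subset.Properties
  using (⊆-antisym; x∈p∪q⁻; x∈p∪q⁺; x∈⁅x⁆; x∈⁅y⁆⇒x≡y; p─q⊆p; x∈p∧x≢y⇒x∈p-y; _∈?_;
         ∪-idempotentCommutativeMonoid; ∪-comm)
open import Data.Sum using (_⊎_; inj₁; inj₂; [_,_])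
open import Data.Vec using (_∷_)
import Data.Vec as Vec
open import Data.List using (List; []; _∷_; map; filter; length; deduplicate; allFin)
open import Data.List.Properties using (filter-all; filter-notAll; length-map)
open import Data.List.Membership.Propositional using (_∈_; _∉_; find; lose)
open import Data.List.Membership.Propositional.Properties using (∈-filter⁺; ∈-filter⁻; ∈-map⁺; ∈-map⁻; ∈-deduplicate⁺; ∈-deduplicate⁻; ∈-allFin)
open import Data.List.Relation.Unary.Any using (Any; here; there)
open import Data.List.Relation.Unary.All using (All; []; _∷_)
import Data.List.Relation.Unary.All as All
open import Data.List.Relation.Unary.Unique.Propositional using (Unique)
open import Data.List.Relation.Unary.Unique.Propositional.Properties using (filter⁺; allFin⁺)
open import Data.Nat.Tactic.RingSolver using (solve-∀)
open import Data.List.Relation.Unary.AllPairs using ([]; _∷_)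
open import Data.Product using (Σ; _×_; _,_; proj₁; proj₂)
open import Data.Empty using (⊥-elim)
open import Function using (_∘_; id)
import Relation.Binary.PropositionalEquality
open import Relation.Binary.PropositionalEquality
  using (_≡_; _≢_; refl; sym; trans; cong; cong₂; subst; subst₂)
open Relation.Binary.PropositionalEquality.≡-Reasoning
open import Relation.Binary.Definitions using (DecidableEquality)
open import Relation.Nullary using (¬_; yes; no; ¬?)
open import Data.Integer using (+_; _-_; _⊖_)
open import Data.Integer.Properties using (m-n≡m⊖n; +-cancelˡ-⊖)
open import Function.Bundles using (_⇔_; mk⇔; Equivalence)
open import Relation.Unary using (Decidable)
open import Relation.Unary.Properties using (∁?; _∩?_)

count : {A : Set} {P : A → Set} → Decidable P → List A → ℕ
count P? xs = length (filter P? xs)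

module _ {A : Set} {P Q : A → Set} (P? : Decidable P) (Q? : Decidable Q) where

  count-cong : ∀ xs → (∀ {x} → x ∈ xs → P x → Q x) → (∀ {x} → x ∈ xs → Q x → P x) →
               count P? xs ≡ count Q? xs
  count-cong []       to from = refl
  count-cong (x ∷ xs) to from with P? x | Q? x
  ... | yes _  | yes _  = cong suc (count-cong xs (to ∘ there) (from ∘ there))
  ... | yes px | no ¬qx = ⊥-elim (¬qx (to (here refl) px))
  ... | no ¬px | yes qx = ⊥-elim (¬px (from (here refl) qx))
  ... | no _   | no _   = count-cong xs (to ∘ there) (from ∘ there)

  count-mono : ∀ xs → (∀ {x} → x ∈ xs → P x → Q x) → count P? xs ≤ count Q? xs
  count-mono []       to = z≤n
  count-mono (x ∷ xs) to with P? x | Q? x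
  ... | yes _  | yes _  = s≤s (count-mono xs (to ∘ there))
  ... | yes px | no ¬qx = ⊥-elim (¬qx (to (here refl) px))
  ... | no _   | yes _  = m≤n⇒m≤1+n (count-mono xs (to ∘ there))
  ... | no _   | no _   = count-mono xs (to ∘ there)

  count-split : ∀ xs → count P? xs ≡ count (P? ∩? Q?) xs + count (P? ∩? ∁? Q?) xs
  count-split []       = refl
  count-split (x ∷ xs) with P? x | Q? x
  ... | yes _ | yes _ = cong suc (count-split xs)
  ... | yes _ | no _  = trans (cong suc (count-split xs)) (sym (+-suc _ _))
  ... | no _  | _     = count-split xs

  count-filter : ∀ xs → count P? (filter Q? xs) ≡ count (Q? ∩? P?) xs
  count-filter []       = refl
  count-filter (x ∷ xs) with Q? x
  ... | no _  = count-filter xs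
  ... | yes _ with P? x
  ...   | yes _ = cong suc (count-filter xs)
  ...   | no _  = count-filter xs

module _ {A : Set} {P : A → Set} (P? : Decidable P) where

  length-split : ∀ xs → length xs ≡ count P? xs + count (∁? P?) xs
  length-split []       = refl
  length-split (x ∷ xs) with P? x
  ... | yes _ = cong suc (length-split xs)
  ... | no _  = trans (cong suc (length-split xs)) (sym (+-suc _ _))

  count-none : ∀ xs → (∀ {x} → x ∈ xs → ¬ P x) → count P? xs ≡ 0
  count-none []       none = refl
  count-none (x ∷ xs) none with P? x
  ... | yes px = ⊥-elim (none (here refl) px)
  ... | no _   = count-none xs (none ∘ there)

  count-map : ∀ {B : Set} (f : B → A) xs → count P? (map f xs) ≡ count (P? ∘ f) xs
  count-map f []       = refl
  count-map f (x ∷ xs) with P? (f x)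
  ... | yes _ = cong suc (count-map f xs)
  ... | no _  = count-map f xs

InjectiveOn : {A B : Set} → (A → B) → List A → Set
InjectiveOn f xs = ∀ {x y} → x ∈ xs → y ∈ xs → f x ≡ f y → x ≡ y

unique-map : {A B : Set} (f : A → B) (xs : List A) → Unique xs → InjectiveOn f xs → Unique (map f xs)
unique-map f []       []          inj = []
unique-map f (x ∷ xs) (x∉xs ∷ u) inj =
  distinct xs x∉xs (λ m → m) ∷ unique-map f xs u (λ p q → inj (there p) (there q))
  where
  distinct : ∀ zs → All (x ≢_) zs → (∀ {y} → y ∈ zs → y ∈ xs) → All (f x ≢_) (map f zs)
  distinct []       []         sub = []
  distinct (z ∷ zs) (x≢z ∷ ne) sub =
    (λ e → x≢z (inj (here refl) (there (sub (here refl))) e)) ∷ distinct zs ne (sub ∘ there)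

module _ {A : Set} (_≟_ : DecidableEquality A) where

  unique-⊆-length : ∀ xs ys → Unique xs → (∀ {x} → x ∈ xs → x ∈ ys) → length xs ≤ length ys
  unique-⊆-length []       ys u sub = z≤n
  unique-⊆-length (x ∷ xs) ys (x∉xs ∷ u) sub =
    ≤-trans (s≤s (unique-⊆-length xs others u (λ m → ∈-filter⁺ (¬? ∘ (x ≟_)) (sub (there m)) (All.lookup x∉xs m))))
            (filter-notAll (¬? ∘ (x ≟_)) ys (¬¬-self (sub (here refl))))
    where
    others : List A
    others = filter (¬? ∘ (x ≟_)) ys
    ¬¬-self : ∀ {zs} → x ∈ zs → Any (λ y → ¬ ¬ (x ≡ y)) zs
    ¬¬-self (here e) = here (λ k → k e)
    ¬¬-self (there m) = there (¬¬-self m)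

  deduplicate-unique : ∀ xs → Unique xs → deduplicate _≟_ xs ≡ xs
  deduplicate-unique []       []          = refl
  deduplicate-unique (x ∷ xs) (x∉xs ∷ u) rewrite deduplicate-unique xs u =
    cong (x ∷_) (filter-all (¬? ∘ (x ≟_)) x∉xs)

  injection-length : {B : Set} (f : B → A) (xs : List B) (ys : List A) → Unique xs → InjectiveOn f xs →
                     (∀ {x} → x ∈ xs → f x ∈ ys) → length xs ≤ length ys
  injection-length f xs ys u inj into =
    subst (_≤ length ys) (length-map f xs)
      (unique-⊆-length (map f xs) ys (unique-map f xs u inj) mapped)
    where
    mapped : ∀ {y} → y ∈ map f xs → y ∈ ys
    mapped m with ∈-map⁻ f m
    ... | x , mx , refl = into mx

private variable n : ℕ

∈-∪⁅⁆⁻ : ∀ {x b : Fin n} {p} → x ∈ˢ p ∪ ⁅ b ⁆ → x ∈ˢ p ⊎ x ≡ b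
∈-∪⁅⁆⁻ {b = b} {p} m with x∈p∪q⁻ p ⁅ b ⁆ m
... | inj₁ h = inj₁ h
... | inj₂ h = inj₂ (x∈⁅y⁆⇒x≡y b h)

∈-∪⁅⁆⁺ : ∀ {x b : Fin n} {p} → x ∈ˢ p → x ∈ˢ p ∪ ⁅ b ⁆
∈-∪⁅⁆⁺ m = x∈p∪q⁺ (inj₁ m)

b∈p∪⁅b⁆ : ∀ {b : Fin n} {p} → b ∈ˢ p ∪ ⁅ b ⁆
b∈p∪⁅b⁆ {b = b} = x∈p∪q⁺ (inj₂ (x∈⁅x⁆ b))

∉-─ : ∀ {x : Fin n} p q → x ∈ˢ q → x ∉ˢ p ─ q
∉-─ (_ ∷ p) (inside ∷ q) Vec.here ()
∉-─ (_ ∷ p) (_ ∷ q) (Vec.there x∈q) (Vec.there m) = ∉-─ p q x∈q m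

∈-∖⁻ : ∀ {x a : Fin n} {p} → x ∈ˢ p ∖ a → x ∈ˢ p × x ≢ a
∈-∖⁻ {a = a} {p} m = p─q⊆p p ⁅ a ⁆ m , λ { refl → ∉-─ p ⁅ a ⁆ (x∈⁅x⁆ a) m }

a∉p∖a : ∀ {a : Fin n} {p} → a ∉ˢ p ∖ a
a∉p∖a m = proj₂ (∈-∖⁻ m) refl

∪⁅⁆-present : ∀ {b : Fin n} {p} → b ∈ˢ p → p ∪ ⁅ b ⁆ ≡ p
∪⁅⁆-present b∈p = ⊆-antisym (λ m → [ (λ h → h) , (λ { refl → b∈p }) ] (∈-∪⁅⁆⁻ m)) ∈-∪⁅⁆⁺

∖-absent : ∀ {a : Fin n} {p} → a ∉ˢ p → p ∖ a ≡ p
∖-absent a∉p = ⊆-antisym (proj₁ ∘ ∈-∖⁻) (λ m → x∈p∧x≢y⇒x∈p-y m (λ { refl → a∉p m }))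

∪⁅⁆∖ : ∀ {b : Fin n} {p} → b ∉ˢ p → (p ∪ ⁅ b ⁆) ∖ b ≡ p
∪⁅⁆∖ b∉p = ⊆-antisym
  (λ m → let (m′ , x≢b) = ∈-∖⁻ m in [ (λ h → h) , (⊥-elim ∘ x≢b) ] (∈-∪⁅⁆⁻ m′))
  (λ m → x∈p∧x≢y⇒x∈p-y (∈-∪⁅⁆⁺ m) (λ { refl → b∉p m }))

∖∪⁅⁆ : ∀ {a : Fin n} {p} → a ∈ˢ p → (p ∖ a) ∪ ⁅ a ⁆ ≡ p
∖∪⁅⁆ {a = a} a∈p = ⊆-antisym
  (λ m → [ proj₁ ∘ ∈-∖⁻ , (λ { refl → a∈p }) ] (∈-∪⁅⁆⁻ m))
  (λ {x} m → case-≟ x m)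
  where
  case-≟ : ∀ x → x ∈ˢ _ → x ∈ˢ (_ ∖ a) ∪ ⁅ a ⁆
  case-≟ x m with x ≟ a
  ... | yes refl = b∈p∪⁅b⁆
  ... | no x≢a   = ∈-∪⁅⁆⁺ (x∈p∧x≢y⇒x∈p-y m x≢a)

⊆⇒∪≡ : ∀ {p q : Subset n} → q ⊆ p → q ∪ p ≡ p
⊆⇒∪≡ {p = p} {q} q⊆p = ⊆-antisym (λ m → [ q⊆p , (λ h → h) ] (x∈p∪q⁻ q p m)) (λ m → x∈p∪q⁺ (inj₂ m))

∪-completes : ∀ {b : Fin n} {q x} → b ∈ˢ q → q ⊆ x ∪ ⁅ b ⁆ → q ∪ x ≡ x ∪ ⁅ b ⁆
∪-completes {q = q} {x} b∈q q⊆ = ⊆-antisym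
  (λ m → [ q⊆ , ∈-∪⁅⁆⁺ ] (x∈p∪q⁻ q x m))
  (λ m → [ (λ h → x∈p∪q⁺ (inj₂ h)) , (λ { refl → x∈p∪q⁺ (inj₁ b∈q) }) ] (∈-∪⁅⁆⁻ m))

module Balance (L : Family n) (uL : Unique L) (a : Fin n) where

  A? : Decidable (a ∈ˢ_)
  A? = a ∈?_

  D? : Decidable (λ z → (z ∖ a) ∈ L)
  D? z = (z ∖ a) ∈ᶠ? L

  U? : Decidable (λ z → (z ∪ ⁅ a ⁆) ∈ L)
  U? z = (z ∪ ⁅ a ⁆) ∈ᶠ? L

  -- z ↦ z ∖ a is a bijection from the members of L containing a whose
  -- removal stays in L onto the members missing a whose extension is in L.
  removable≡addable : count (A? ∩? D?) L ≡ count (∁? A? ∩? U?) L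
  removable≡addable = ≤-antisym
    (injection-length _≟ˢ_ (_∖ a) X Y (filter⁺ (A? ∩? D?) uL) injX intoY)
    (injection-length _≟ˢ_ (_∪ ⁅ a ⁆) Y X (filter⁺ (∁? A? ∩? U?) uL) injY intoX)
    where
    X Y : Family n
    X = filter (A? ∩? D?) L
    Y = filter (∁? A? ∩? U?) L
    injX : InjectiveOn (_∖ a) X
    injX {x} {y} mx my e = begin
      x                  ≡⟨ ∖∪⁅⁆ (proj₁ (proj₂ (∈-filter⁻ (A? ∩? D?) {xs = L} mx))) ⟨
      (x ∖ a) ∪ ⁅ a ⁆    ≡⟨ cong (_∪ ⁅ a ⁆) e ⟩
      (y ∖ a) ∪ ⁅ a ⁆    ≡⟨ ∖∪⁅⁆ (proj₁ (proj₂ (∈-filter⁻ (A? ∩? D?) {xs = L} my))) ⟩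
      y                  ∎
    intoY : ∀ {z} → z ∈ X → z ∖ a ∈ Y
    intoY mz with ∈-filter⁻ (A? ∩? D?) {xs = L} mz
    ... | z∈L , a∈z , z∖a∈L =
      ∈-filter⁺ (∁? A? ∩? U?) z∖a∈L (a∉p∖a , subst (_∈ L) (sym (∖∪⁅⁆ a∈z)) z∈L)
    injY : InjectiveOn (_∪ ⁅ a ⁆) Y
    injY {x} {y} mx my e = begin
      x                  ≡⟨ ∪⁅⁆∖ (proj₁ (proj₂ (∈-filter⁻ (∁? A? ∩? U?) {xs = L} mx))) ⟨
      (x ∪ ⁅ a ⁆) ∖ a    ≡⟨ cong (_∖ a) e ⟩
      (y ∪ ⁅ a ⁆) ∖ a    ≡⟨ ∪⁅⁆∖ (proj₁ (proj₂ (∈-filter⁻ (∁? A? ∩? U?) {xs = L} my))) ⟩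
      y                  ∎
    intoX : ∀ {z} → z ∈ Y → z ∪ ⁅ a ⁆ ∈ X
    intoX mz with ∈-filter⁻ (∁? A? ∩? U?) {xs = L} mz
    ... | z∈L , a∉z , z∪a∈L =
      ∈-filter⁺ (A? ∩? D?) z∪a∈L (b∈p∪⁅b⁆ , subst (_∈ L) (sym (∪⁅⁆∖ a∉z)) z∈L)

  P-count : length (P L a) ≡ count (A? ∩? ∁? D?) L
  P-count = count-cong (∁? D?) (A? ∩? ∁? D?) L contains (λ _ → proj₂)
    where
    contains : ∀ {z} → z ∈ L → (z ∖ a) ∉ L → a ∈ˢ z × (z ∖ a) ∉ L
    contains {z} z∈L z∖a∉L with A? z
    ... | yes a∈z = a∈z , z∖a∉L
    ... | no a∉z  = ⊥-elim (z∖a∉L (subst (_∈ L) (sym (∖-absent a∉z)) z∈L))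

  S-count : length (S L a) ≡ count (∁? A? ∩? ∁? U?) L
  S-count = count-cong (∁? U?) (∁? A? ∩? ∁? U?) L misses (λ _ → proj₂)
    where
    misses : ∀ {z} → z ∈ L → (z ∪ ⁅ a ⁆) ∉ L → a ∉ˢ z × (z ∪ ⁅ a ⁆) ∉ L
    misses {z} z∈L z∪a∉L with A? z
    ... | yes a∈z = ⊥-elim (z∪a∉L (subst (_∈ L) (sym (∪⁅⁆-present a∈z)) z∈L))
    ... | no a∉z  = a∉z , z∪a∉L

  balance : length (P L a) + length L ≡ 2 * length (Fa L a) + length (S L a)
  balance = begin
    length (P L a) + length L
      ≡⟨ cong₂ _+_ P-count (length-split A? L) ⟩
    count (A? ∩? ∁? D?) L + (count A? L + count (∁? A?) L)
      ≡⟨ cong (λ k → count (A? ∩? ∁? D?) L + (count A? L + k))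
              (trans (count-split (∁? A?) U? L) (cong (_+ count (∁? A? ∩? ∁? U?) L) (sym removable≡addable))) ⟩
    count (A? ∩? ∁? D?) L + (count A? L + (count (A? ∩? D?) L + count (∁? A? ∩? ∁? U?) L))
      ≡⟨ rearrange (count (A? ∩? ∁? D?) L) (count A? L) (count (A? ∩? D?) L) _ ⟩
    count A? L + (count (A? ∩? D?) L + count (A? ∩? ∁? D?) L) + count (∁? A? ∩? ∁? U?) L
      ≡⟨ cong₂ (λ k m → count A? L + k + m) (sym (count-split A? D? L)) (sym S-count) ⟩
    count A? L + count A? L + length (S L a)
      ≡⟨ cong (λ k → k + length (S L a)) (cong (λ k → count A? L + k) (sym (+-identityʳ _))) ⟩
    2 * length (Fa L a) + length (S L a) ∎
    where
    rearrange : ∀ p c d s → p + (c + (d + s)) ≡ c + (d + p) + s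
    rearrange = solve-∀

UpClosed : Family n → Fin n → Set
UpClosed T a = ∀ {x} → x ∈ T → x ∪ ⁅ a ⁆ ∈ T

NoneBelow : Family n → Subset n → Set
NoneBelow T y = ∀ {w} → w ∈ T → ¬ (w ⊆ y)

module _ (φ : Subset n → Subset n) (F : Family n) where

  image⁺ : ∀ {u} → u ∈ F → φ u ∈ image φ F
  image⁺ m = ∈-deduplicate⁺ _≟ˢ_ (∈-map⁺ φ m)

  image⁻ : ∀ {x} → x ∈ image φ F → Σ (Subset n) λ u → u ∈ F × x ≡ φ u
  image⁻ m = ∈-map⁻ φ (∈-deduplicate⁻ _≟ˢ_ (map φ F) m)

  image-injective : Unique F → InjectiveOn φ F → image φ F ≡ map φ F
  image-injective uF inj = deduplicate-unique _≟ˢ_ (map φ F) (unique-map φ F uF inj)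

module RisingStep {n : ℕ} (T : Family n) (ucT : UnionClosed T) (b : Fin n) where

  open import Algebra.Solver.IdempotentCommutativeMonoid (∪-idempotentCommutativeMonoid n)
    using (solve; _⊜_; _⊕_)

  ψ : Subset n → Subset n
  ψ = rise T b

  T′ : Family n
  T′ = image ψ T

  B : Subset n
  B = ⁅ b ⁆

  data RiseView (p ψp : Subset n) : Set where
    kept   : p ∪ B ∈ T → ψp ≡ p → RiseView p ψp
    raised : p ∪ B ∉ T → ψp ≡ p ∪ B → RiseView p ψp

  view : ∀ p → RiseView p (ψ p)
  view p with (p ∪ ⁅ b ⁆) ∈ᶠ? T
  ... | yes h = kept h refl
  ... | no h  = raised h refl

  rise-kept : ∀ {p} → p ∪ B ∈ T → ψ p ≡ p
  rise-kept {p} h with view p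
  ... | kept _ e     = e
  ... | raised h′ _  = ⊥-elim (h′ h)

  rise-∪ : ∀ p → ψ p ∪ B ≡ p ∪ B
  rise-∪ p with view p
  ... | kept _ e   = cong (_∪ B) e
  ... | raised _ e = trans (cong (_∪ B) e) (solve 2 (λ p B → (p ⊕ B) ⊕ B ⊜ p ⊕ B) refl p B)

  rise-⊇ : ∀ p → p ⊆ ψ p
  rise-⊇ p with view p
  ... | kept _ e   = subst (p ⊆_) (sym e) (λ m → m)
  ... | raised _ e = subst (p ⊆_) (sym e) ∈-∪⁅⁆⁺

  rise-⊆ : ∀ p {x} → x ∈ˢ ψ p → x ∈ˢ p ⊎ x ≡ b
  rise-⊆ p m with view p
  ... | kept _ e   = inj₁ (subst (_ ∈ˢ_) e m)
  ... | raised _ e = ∈-∪⁅⁆⁻ (subst (_ ∈ˢ_) e m)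

  ∪B∈T′ : ∀ {p} → p ∈ T → p ∪ B ∈ T′
  ∪B∈T′ {p} m with view p
  ... | kept h _   = subst (_∈ T′) (rise-kept (subst (_∈ T) (solve 2 (λ p B → p ⊕ B ⊜ (p ⊕ B) ⊕ B) refl p B) h))
                                    (image⁺ ψ T h)
  ... | raised _ e = subst (_∈ T′) e (image⁺ ψ T m)

  kept-∈ : ∀ {p} → p ∈ T → b ∈ˢ p → p ∪ B ∈ T
  kept-∈ m b∈p = subst (_∈ T) (sym (∪⁅⁆-present b∈p)) m

  -- ψ is injective on T: a raised set p ∪ B is never a member of T.
  rise-injective : InjectiveOn ψ T
  rise-injective {p} {q} mp mq e with view p | view q
  ... | kept _ ep   | kept _ eq   = trans (sym ep) (trans e eq)
  ... | kept _ ep   | raised hq eq = ⊥-elim (hq (subst (_∈ T) (trans (sym ep) (trans e eq)) mp))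
  ... | raised hp ep | kept _ eq   = ⊥-elim (hp (subst (_∈ T) (trans (sym eq) (trans (sym e) ep)) mq))
  ... | raised hp ep | raised hq eq = begin
    p             ≡⟨ ∪⁅⁆∖ (hp ∘ kept-∈ mp) ⟨
    (p ∪ B) ∖ b   ≡⟨ cong (_∖ b) (trans (sym ep) (trans e eq)) ⟩
    (q ∪ B) ∖ b   ≡⟨ ∪⁅⁆∖ (hq ∘ kept-∈ mq) ⟩
    q             ∎

  raised-∪ : ∀ p q → ψ p ≡ p ∪ B → ψ p ∪ ψ q ≡ (p ∪ q) ∪ B
  raised-∪ p q e = begin
    ψ p ∪ ψ q        ≡⟨ cong (_∪ ψ q) e ⟩
    (p ∪ B) ∪ ψ q    ≡⟨ solve 3 (λ p B y → (p ⊕ B) ⊕ y ⊜ p ⊕ (y ⊕ B)) refl p B (ψ q) ⟩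
    p ∪ (ψ q ∪ B)    ≡⟨ cong (p ∪_) (rise-∪ q) ⟩
    p ∪ (q ∪ B)      ≡⟨ solve 3 (λ p q B → p ⊕ (q ⊕ B) ⊜ (p ⊕ q) ⊕ B) refl p q B ⟩
    (p ∪ q) ∪ B      ∎

  rise-unionClosed : UnionClosed T′
  rise-unionClosed f g mf mg with image⁻ ψ T mf | image⁻ ψ T mg
  ... | p , mp , refl | q , mq , refl with view p | view q
  ...   | raised _ ep | _ = subst (_∈ T′) (sym (raised-∪ p q ep)) (∪B∈T′ (ucT p q mp mq))
  ...   | kept _ ep | raised _ eq =
          subst (_∈ T′) (sym (trans (∪-comm (ψ p) (ψ q)) (trans (raised-∪ q p eq) (cong (_∪ B) (∪-comm q p)))))
                (∪B∈T′ (ucT p q mp mq))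
  ...   | kept hp ep | kept hq eq =
          subst (_∈ T′) (trans (rise-kept pq∪B∈T) (sym (cong₂ _∪_ ep eq))) (image⁺ ψ T (ucT p q mp mq))
          where
          pq∪B∈T : (p ∪ q) ∪ B ∈ T
          pq∪B∈T = subst (_∈ T) (solve 3 (λ p q B → (p ⊕ B) ⊕ (q ⊕ B) ⊜ (p ⊕ q) ⊕ B) refl p q B)
                             (ucT (p ∪ B) (q ∪ B) hp hq)

  rise-upClosed-b : UpClosed T′ b
  rise-upClosed-b mx with image⁻ ψ T mx
  ... | p , mp , refl = subst (_∈ T′) (sym (rise-∪ p)) (∪B∈T′ mp)

  rise-edge : ∀ {p c} → p ∪ ⁅ c ⁆ ∈ T → ψ p ∪ ⁅ c ⁆ ∈ T′
  rise-edge {p} {c} h with view p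
  ... | raised _ e = subst (_∈ T′) (sym (trans (cong (_∪ ⁅ c ⁆) e) (solve 3 (λ p B C → (p ⊕ B) ⊕ C ⊜ (p ⊕ C) ⊕ B) refl p B ⁅ c ⁆)))
                           (∪B∈T′ h)
  ... | kept hp e  = subst (_∈ T′) (trans (rise-kept pc∪B∈T) (sym (cong (_∪ ⁅ c ⁆) e))) (image⁺ ψ T h)
    where
    pc∪B∈T : (p ∪ ⁅ c ⁆) ∪ B ∈ T
    pc∪B∈T = subst (_∈ T) (solve 3 (λ p B C → (p ⊕ C) ⊕ (p ⊕ B) ⊜ (p ⊕ C) ⊕ B) refl p B ⁅ c ⁆) (ucT _ _ h hp)

  rise-upClosed : ∀ {c} → UpClosed T c → UpClosed T′ c
  rise-upClosed up mx with image⁻ ψ T mx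
  ... | p , mp , refl = rise-edge (up mp)

  rise-noneBelow-new : ∀ {p} → p ∈ T → b ∉ˢ p → b ∈ˢ ψ p → NoneBelow T′ (ψ p ∖ b)
  rise-noneBelow-new {p} mp b∉p b∈ψp mw w⊆ with view p | image⁻ ψ T mw
  ... | kept _ e    | _ = b∉p (subst (b ∈ˢ_) e b∈ψp)
  ... | raised hp e | q , mq , refl with view q
  ...   | raised _ eq = a∉p∖a (w⊆ (subst (b ∈ˢ_) (sym eq) b∈p∪⁅b⁆))
  ...   | kept hq _  = hp (subst (_∈ T) q∪B∪p≡p∪B (ucT _ _ hq mp))
    where
    q⊆p : q ⊆ p
    q⊆p m with ∈-∖⁻ (w⊆ (rise-⊇ q m))
    ... | m′ , y≢b = [ (λ h → h) , (⊥-elim ∘ y≢b) ] (rise-⊆ p m′)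
    q∪B∪p≡p∪B : (q ∪ B) ∪ p ≡ p ∪ B
    q∪B∪p≡p∪B = trans (solve 3 (λ q B p → (q ⊕ B) ⊕ p ⊜ (q ⊕ p) ⊕ B) refl q B p) (cong (_∪ B) (⊆⇒∪≡ q⊆p))

  rise-noneBelow-keep : ∀ {x c} → x ∈ T → NoneBelow T (x ∖ c) → NoneBelow T′ (ψ x ∖ c)
  rise-noneBelow-keep {x} {c} mx none mw w⊆ with image⁻ ψ T mw
  ... | q , mq , refl with view x
  ...   | kept _ e = none mq (λ m → subst (λ s → _ ∈ˢ s ∖ c) e (w⊆ (rise-⊇ q m)))
  ...   | raised hx e with b ∈? q
  ...     | yes b∈q = hx (subst (_∈ T) (∪-completes b∈q (proj₁ ∘ ∈-∖⁻ ∘ below)) (ucT q x mq mx))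
    where
    below : q ⊆ (x ∪ B) ∖ c
    below m = subst (λ s → _ ∈ˢ s ∖ c) e (w⊆ (rise-⊇ q m))
  ...     | no b∉q = none mq q⊆x∖c
    where
    q⊆x∖c : q ⊆ x ∖ c
    q⊆x∖c {y} m with ∈-∖⁻ (subst (λ s → y ∈ˢ s ∖ c) e (w⊆ (rise-⊇ q m)))
    ... | m′ , y≢c = x∈p∧x≢y⇒x∈p-y ([ (λ h → h) , (λ { refl → ⊥-elim (b∉q m) }) ] (∈-∪⁅⁆⁻ m′)) y≢c

module _ {F : Family n} (φ ψ : Subset n → Subset n) where

  image-∘⁺ : ∀ {x} → x ∈ image ψ (image φ F) → x ∈ image (ψ ∘ φ) F
  image-∘⁺ m with image⁻ ψ (image φ F) m
  ... | p , mp , refl with image⁻ φ F mp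
  ...   | u , mu , refl = image⁺ (ψ ∘ φ) F mu

  image-∘⁻ : ∀ {x} → x ∈ image (ψ ∘ φ) F → x ∈ image ψ (image φ F)
  image-∘⁻ m with image⁻ (ψ ∘ φ) F m
  ... | u , mu , refl = image⁺ ψ (image φ F) (image⁺ φ F mu)

record Rising (F : Family n) (φ : Subset n → Subset n) (done : List (Fin n)) : Set where
  field
    injective   : InjectiveOn φ F
    unionClosed : UnionClosed (image φ F)
    extensive   : ∀ {u} → u ∈ F → u ⊆ φ u
    unadded     : ∀ {a u} → a ∉ done → u ∈ F → a ∈ˢ φ u → a ∈ˢ u
    edges       : ∀ {a u} → u ∪ ⁅ a ⁆ ∈ F → φ u ∪ ⁅ a ⁆ ∈ image φ F
    upClosed    : ∀ {a} → a ∈ done → UpClosed (image φ F) a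
    unraised    : ∀ {a u} → a ∈ done → u ∈ F → a ∉ˢ u → u ∪ ⁅ a ⁆ ∈ F → a ∉ˢ φ u
    spurious    : ∀ {a u} → a ∈ done → u ∈ F → a ∉ˢ u → a ∈ˢ φ u → NoneBelow (image φ F) (φ u ∖ a)

rising-start : ∀ {F : Family n} → UnionClosed F → Rising F id []
rising-start {F = F} ucF = record
  { injective   = λ _ _ e → e
  ; unionClosed = unionClosed
  ; extensive   = λ _ m → m
  ; unadded     = λ _ _ m → m
  ; edges       = image⁺ id F
  ; upClosed    = λ ()
  ; unraised    = λ ()
  ; spurious    = λ ()
  }
  where
  unionClosed : UnionClosed (image id F)
  unionClosed f g mf mg with image⁻ id F mf | image⁻ id F mg
  ... | u , mu , refl | v , mv , refl = image⁺ id F (ucF u v mu mv)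

rising-step : ∀ {F : Family n} {φ done} → Rising F φ done → ∀ b → b ∉ done →
              Rising F (rise (image φ F) b ∘ φ) (b ∷ done)
rising-step {F = F} {φ} {done} R b b∉done = record
  { injective   = λ mu mv e → injective mu mv (rise-injective (image⁺ φ F mu) (image⁺ φ F mv) e)
  ; unionClosed = λ f g mf mg → into (rise-unionClosed f g (from mf) (from mg))
  ; extensive   = λ {u} mu → rise-⊇ (φ u) ∘ extensive mu
  ; unadded     = unadded′
  ; edges       = into ∘ rise-edge ∘ edges
  ; upClosed    = upClosed′
  ; unraised    = unraised′
  ; spurious    = spurious′
  }
  where
  open Rising R
  open RisingStep (image φ F) unionClosed b
  into : ∀ {x} → x ∈ T′ → x ∈ image (ψ ∘ φ) F
  into = image-∘⁺ φ ψ
  from : ∀ {x} → x ∈ image (ψ ∘ φ) F → x ∈ T′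
  from = image-∘⁻ φ ψ

  unadded′ : ∀ {a u} → a ∉ b ∷ done → u ∈ F → a ∈ˢ ψ (φ u) → a ∈ˢ u
  unadded′ a∉ mu m = [ unadded (a∉ ∘ there) mu , (λ a≡b → ⊥-elim (a∉ (here a≡b))) ] (rise-⊆ _ m)

  upClosed′ : ∀ {a} → a ∈ b ∷ done → UpClosed (image (ψ ∘ φ) F) a
  upClosed′ (here refl) = into ∘ rise-upClosed-b ∘ from
  upClosed′ (there ma)  = into ∘ rise-upClosed (upClosed ma) ∘ from

  unraised′ : ∀ {a u} → a ∈ b ∷ done → u ∈ F → a ∉ˢ u → u ∪ ⁅ a ⁆ ∈ F → a ∉ˢ ψ (φ u)
  unraised′ (here refl) mu a∉u edge m =
    a∉u (unadded b∉done mu (subst (b ∈ˢ_) (rise-kept (edges edge)) m))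
  unraised′ (there ma) mu a∉u edge m =
    [ unraised ma mu a∉u edge , (λ { refl → b∉done ma }) ] (rise-⊆ _ m)

  spurious′ : ∀ {a u} → a ∈ b ∷ done → u ∈ F → a ∉ˢ u → a ∈ˢ ψ (φ u) →
              NoneBelow (image (ψ ∘ φ) F) (ψ (φ u) ∖ a)
  spurious′ (here refl) mu a∉u m =
    rise-noneBelow-new (image⁺ φ F mu) (a∉u ∘ unadded b∉done mu) m ∘ from
  spurious′ (there ma) mu a∉u m =
    [ (λ a∈φu → rise-noneBelow-keep (image⁺ φ F mu) (spurious ma mu a∉u a∈φu) ∘ from)
    , (λ { refl → ⊥-elim (b∉done ma) }) ] (rise-⊆ _ m)

rising-word : ∀ {F : Family n} (bs : List (Fin n)) {φ done} → Rising F φ done → Unique bs →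
              (∀ {c} → c ∈ bs → c ∉ done) →
              Σ (List (Fin n)) λ done′ → Rising F (riseWord F bs φ) done′ ×
                (∀ {c} → c ∈ bs ⊎ c ∈ done → c ∈ done′)
rising-word []       R _ _ = _ , R , [ (λ ()) , (λ m → m) ]
rising-word (b ∷ bs) {done = done} R (b∉bs ∷ u) fresh
  with rising-word bs (rising-step R b (fresh (here refl))) u fresh′
  where
  fresh′ : ∀ {c} → c ∈ bs → c ∉ b ∷ done
  fresh′ m (here refl) = All.lookup b∉bs m refl
  fresh′ m (there m′)  = fresh (there m) m′
... | done′ , R′ , ⊆done′ = done′ , R′ , [ step , ⊆done′ ∘ inj₂ ∘ there ]
  where
  step : ∀ {c} → c ∈ b ∷ bs → c ∈ done′
  step (here refl) = ⊆done′ (inj₂ (here refl))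
  step (there m)   = ⊆done′ (inj₁ m)

rising-φw : ∀ {F : Family n} → UnionClosed F →
            Σ (List (Fin n)) λ done → Rising F (φw F) done × (∀ a → a ∈ done)
rising-φw {n = n} ucF with rising-word (allFin n) (rising-start ucF) (allFin⁺ n) (λ _ ())
... | done , R , ⊆done = done , R , λ a → ⊆done (inj₁ (∈-allFin a))

module WordCount (F : Family n) (uF : Unique F) (ucF : UnionClosed F) (a : Fin n) where

  private
    φ : Subset n → Subset n
    φ = φw F

    G : Family n
    G = image φ F

    done : List (Fin n)
    done = proj₁ (rising-φw ucF)

    allDone : ∀ c → c ∈ done
    allDone = proj₂ (proj₂ (rising-φw ucF))

  open Rising (proj₁ (proj₂ (rising-φw ucF)))

  A? : Decidable (a ∈ˢ_)
  A? = a ∈?_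

  Φ? : Decidable (λ z → a ∈ˢ φ z)
  Φ? z = a ∈? φ z

  E? : Decidable (λ z → (φ z ∖ a) ∈ G)
  E? z = (φ z ∖ a) ∈ᶠ? G

  G≡ : G ≡ map φ F
  G≡ = image-injective φ F uF injective

  count-G : ∀ {Q : Subset n → Set} (Q? : Decidable Q) → count Q? G ≡ count (Q? ∘ φ) F
  count-G Q? = trans (cong (count Q?) G≡) (count-map Q? φ F)

  σ-count : length (σw F a) ≡ count (Φ? ∩? ∁? A?) F
  σ-count = trans (count-G _) (count-cong _ (Φ? ∩? ∁? A?) F to from)
    where
    to : ∀ {z} → z ∈ F → a ∈ˢ φ z × Any (λ z′ → φ z′ ≡ φ z × a ∉ˢ z′) F → a ∈ˢ φ z × a ∉ˢ z
    to mz (a∈φz , any) with find any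
    ... | z′ , mz′ , e , a∉z′ = a∈φz , subst (a ∉ˢ_) (injective mz′ mz e) a∉z′
    from : ∀ {z} → z ∈ F → a ∈ˢ φ z × a ∉ˢ z → a ∈ˢ φ z × Any (λ z′ → φ z′ ≡ φ z × a ∉ˢ z′) F
    from mz (a∈φz , a∉z) = a∈φz , lose mz (refl , a∉z)

  π-count : length (πw F a) ≡ count (A? ∩? ∁? E?) F
  π-count = begin
    count (∁? (_∈ᶠ? G) ∘ (_∖ a)) (image φ (Fa F a))
      ≡⟨ cong (count _) (image-injective φ (Fa F a) (filter⁺ A? uF) injFa) ⟩
    count (∁? (_∈ᶠ? G) ∘ (_∖ a)) (map φ (Fa F a))
      ≡⟨ count-map _ φ (Fa F a) ⟩
    count (∁? E?) (Fa F a)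
      ≡⟨ count-filter (∁? E?) A? F ⟩
    count (A? ∩? ∁? E?) F ∎
    where
    injFa : InjectiveOn φ (Fa F a)
    injFa mx my = injective (proj₁ (∈-filter⁻ A? mx)) (proj₁ (∈-filter⁻ A? my))

  -- |φ_w(F)_a| = |F_a| + |σ_w(a)|, since φ_w only adds elements.
  Ga-count : length (Fa G a) ≡ length (Fa F a) + length (σw F a)
  Ga-count = begin
    count A? G                                   ≡⟨ count-G A? ⟩
    count Φ? F                                   ≡⟨ count-split Φ? A? F ⟩
    count (Φ? ∩? A?) F + count (Φ? ∩? ∁? A?) F   ≡⟨ cong₂ _+_ kept (sym σ-count) ⟩
    count A? F + length (σw F a)                 ∎
    where
    kept : count (Φ? ∩? A?) F ≡ count A? F
    kept = count-cong (Φ? ∩? A?) A? F (λ _ → proj₂) (λ mz a∈z → extensive mz a∈z , a∈z)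

  -- |P(φ_w(F),a)| = |π_w(a)| + |σ_w(a)|: an image element η with η ∖ a outside
  -- the image comes either from some z ∋ a (pure) or from a spurious a.
  PG-count : length (P G a) ≡ length (πw F a) + length (σw F a)
  PG-count = begin
    count (∁? (_∈ᶠ? G) ∘ (_∖ a)) G                      ≡⟨ count-G _ ⟩
    count (∁? E?) F                                      ≡⟨ count-split (∁? E?) A? F ⟩
    count (∁? E? ∩? A?) F + count (∁? E? ∩? ∁? A?) F      ≡⟨ cong₂ _+_ pure spurious-only ⟩
    count (A? ∩? ∁? E?) F + count (Φ? ∩? ∁? A?) F         ≡⟨ cong₂ _+_ π-count σ-count ⟨
    length (πw F a) + length (σw F a)                    ∎
    where
    pure : count (∁? E? ∩? A?) F ≡ count (A? ∩? ∁? E?) F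
    pure = count-cong (∁? E? ∩? A?) (A? ∩? ∁? E?) F (λ _ (x , y) → y , x) (λ _ (x , y) → y , x)
    added : ∀ {z} → z ∈ F → (φ z ∖ a) ∉ G → a ∉ˢ z → a ∈ˢ φ z
    added {z} mz φz∖a∉G a∉z with Φ? z
    ... | yes a∈φz = a∈φz
    ... | no a∉φz  = ⊥-elim (φz∖a∉G (subst (_∈ G) (sym (∖-absent a∉φz)) (image⁺ φ F mz)))
    spurious-only : count (∁? E? ∩? ∁? A?) F ≡ count (Φ? ∩? ∁? A?) F
    spurious-only = count-cong (∁? E? ∩? ∁? A?) (Φ? ∩? ∁? A?) F
      (λ mz (φz∖a∉G , a∉z) → added mz φz∖a∉G a∉z , a∉z)
      (λ mz (a∈φz , a∉z) → (λ φz∖a∈G → spurious (allDone a) mz a∉z a∈φz φz∖a∈G (λ m → m)) , a∉z)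

  -- The image is closed under adding a, so S(φ_w(F),a) is empty.
  SG-empty : length (S G a) ≡ 0
  SG-empty = count-none _ G (λ mz z∪a∉G → z∪a∉G (upClosed (allDone a) mz))

  σ≤S : length (σw F a) ≤ length (S F a)
  σ≤S = subst (_≤ length (S F a)) (sym σ-count)
    (count-mono (Φ? ∩? ∁? A?) _ F (λ mz (a∈φz , a∉z) edge → unraised (allDone a) mz a∉z edge a∈φz))

  pure-balance : length (πw F a) + length F ≡ 2 * length (Fa F a) + length (σw F a)
  pure-balance = +-cancelʳ-≡ σ (π + length F) (2 * length (Fa F a) + σ) (begin
    π + length F + σ                      ≡⟨ swap-tail π (length F) σ ⟩
    (π + σ) + length F                    ≡⟨ cong₂ _+_ PG-count |G|≡|F| ⟨
    length (P G a) + length G             ≡⟨ Balance.balance G uG a ⟩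
    2 * length (Fa G a) + length (S G a)  ≡⟨ cong₂ (λ k m → 2 * k + m) Ga-count SG-empty ⟩
    2 * (length (Fa F a) + σ) + 0         ≡⟨ regroup (length (Fa F a)) σ ⟩
    2 * length (Fa F a) + σ + σ           ∎)
    where
    π σ : ℕ
    π = length (πw F a)
    σ = length (σw F a)
    uG : Unique G
    uG = subst Unique (sym G≡) (unique-map φ F uF injective)
    |G|≡|F| : length G ≡ length F
    |G|≡|F| = trans (cong length G≡) (length-map φ F)
    swap-tail : ∀ x l s → x + l + s ≡ (x + s) + l
    swap-tail = solve-∀
    regroup : ∀ f s → 2 * (f + s) + 0 ≡ 2 * f + s + s
    regroup = solve-∀

difference-swap : ∀ m n k l → m + n ≡ k + l → + m - + l ≡ + k - + n
difference-swap m n k l e = begin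
  + m - + l            ≡⟨ m-n≡m⊖n m l ⟩
  m ⊖ l                ≡⟨ +-cancelˡ-⊖ n m l ⟨
  (n + m) ⊖ (n + l)    ≡⟨ cong₂ _⊖_ (trans (+-comm n m) (trans e (+-comm k l))) (+-comm n l) ⟩
  (l + k) ⊖ (l + n)    ≡⟨ +-cancelˡ-⊖ l k n ⟩
  k ⊖ n                ≡⟨ m-n≡m⊖n k n ⟨
  + k - + n            ∎

threshold : ∀ x L c s → x + L ≡ c + s → (L ≤ c ⇔ s ≤ x)
threshold x L c s e = mk⇔
  (λ L≤c → +-cancelʳ-≤ L s x (subst (s + L ≤_) (trans (+-comm s c) (sym e)) (+-monoʳ-≤ s L≤c)))
  (λ s≤x → +-cancelʳ-≤ s L c (subst (L + s ≤_) (trans (+-comm L x) e) (+-monoʳ-≤ L s≤x)))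

dominated : ∀ {x y L c s t} → x + L ≡ c + s → y + L ≡ c + t → s ≤ t → x ≤ y
dominated {x} {y} {L} {c} ex ey s≤t =
  +-cancelʳ-≤ L x y (subst₂ _≤_ (sym ex) (sym ey) (+-monoʳ-≤ c s≤t))

-- Both |π_w(a)| - |σ_w(a)| and |P(F,a)| - |S(F,a)| equal 2|F_a| - |F|; the
-- threshold |F| ≤ 2|F_a| reads σ_w(a) ≤ π_w(a); and σ_w(a) ≤ S(F,a) bounds π_w(a) by P(F,a).
proposition5p5 : ∀ (n : ℕ) (F : Family n) → Unique F → UnionClosed F → Covers F →
    (∀ (a : Fin n) → (+ length (πw F a)) - (+ length (σw F a)) ≡ (+ length (P F a)) - (+ length (S F a)))
    × ((Σ (Fin n) λ a → length F ≤ 2 * length (Fa F a)) ⇔ (Σ (Fin n) λ a → length (σw F a) ≤ length (πw F a)))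
    × (∀ (a : Fin n) → length (πw F a) ≤ length (P F a) × length (σw F a) ≤ length (S F a))
proposition5p5 n F uF ucF _ =
    (λ a → trans (centred (pure-balance a)) (sym (centred (Balance.balance F uF a))))
  , mk⇔ (λ (a , h) → a , Equivalence.to (half a) h) (λ (a , h) → a , Equivalence.from (half a) h)
  , (λ a → dominated (pure-balance a) (Balance.balance F uF a) (σ≤S a) , σ≤S a)
  where
  open WordCount F uF ucF using (pure-balance; σ≤S)
  centred : ∀ {x s a} → x + length F ≡ 2 * length (Fa F a) + s → + x - + s ≡ + (2 * length (Fa F a)) - + length F
  centred {x} {s} {a} = difference-swap x (length F) (2 * length (Fa F a)) s
  half : ∀ a → (length F ≤ 2 * length (Fa F a)) ⇔ (length (σw F a) ≤ length (πw F a))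
  half a = threshold _ _ _ _ (pure-balance a)
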